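{- Let $G:\mathbb{N}\times\mathbb{N}\to\mathbb{N}$ be defined by $$G(m,n)=\frac{1}{4}\left[(m+n+1)^2-\big((m+n+1)\bmod 2\big)\right]+\min(m,n).$$ Then $G$ is a symmetric pairing function on $\mathbb{N}$, in the sense that: $G(m,n)=G(n,m)$ for all $m,n\in\mathbb{N}$; $G$ maps $\mathbb{N}\times\mathbb{N}$ onto $\mathbb{N}$; and for $(x_1,y_1),(x_2,y_2)\in\mathbb{N}\times\mathbb{N}$, $G(x_1,y_1)=G(x_2,y_2)$ holds if and only if $(x_1,y_1)=(x_2,y_2)$ or $(x_1,y_1)=(y_2,x_2)$ (equivalently, the restriction of $G$ to $\{(m,n)\in\mathbb{N}\times\mathbb{N}: m\ge n\}$ is a bijection onto $\mathbb{N}$).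
   Context: $\mathbb{N}=\{0,1,2,\dots\}$ denotes the set of natural numbers including $0$. For an integer $k$, $k\bmod 2$ denotes the least non-negative residue of $k$ modulo $2$. The paper's notion of "symmetric pairing function" is the analogue, on $\mathbb{N}$, of the properties it proves for its function on positive integers: symmetry, surjectivity, and injectivity up to swapping the two arguments. -}

module Defs where

open import Data.Nat using (ℕ; _+_; _*_; _∸_; _⊓_)
open import Data.Nat.DivMod using (_/_; _%_)

-- G(m,n) = ((m+n+1)^2 - ((m+n+1) mod 2)) / 4 + min(m,n)
-- The numerator is always divisible by 4, so ℕ floor division is exact.
G : ℕ → ℕ → ℕ
G m n = ((s * s ∸ s % 2) / 4) + (m ⊓ n)
  where s = m + n + 1

-- The pairs with m + n = d form the d-th diagonal; its unordered pairs are indexed by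
-- min(m,n) ∈ [0, ⌊d/2⌋], so it holds ⌊d/2⌋ + 1 of them. The first term of G is exactly
-- the number of unordered pairs on the diagonals before d, so G enumerates the
-- unordered pairs diagonal by diagonal, each once.
module Submission where

open import Defs
open import Data.Nat
  using (ℕ; zero; suc; _+_; _*_; _∸_; _⊓_; _⊔_; _≤_; _<_; _≤′_; ≤′-refl; ≤′-step; z≤n; s≤s; ⌊_/2⌋; ⌈_/2⌉; _<?_)
open import Data.Nat.Properties
open import Data.Nat.DivMod using (_/_; _%_; m*n/n≡m)
open import Data.Nat.Tactic.RingSolver using (solve-∀)
open import Data.Product using (_×_; _,_; ∃-syntax; swap; uncurry)
open import Data.Sum using (_⊎_; inj₁; inj₂)
open import Data.Empty using (⊥-elim)
open import Relation.Nullary using (yes; no)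
open import Relation.Binary using (tri<; tri≈; tri>)
open import Relation.Binary.PropositionalEquality
open ≡-Reasoning

diagonalOffset : ℕ → ℕ
diagonalOffset zero    = 0
diagonalOffset (suc d) = diagonalOffset d + suc ⌊ d /2⌋

diagonalOffset-+2 : ∀ d → diagonalOffset (suc (suc d)) ≡ diagonalOffset d + suc (suc d)
diagonalOffset-+2 d = begin
  diagonalOffset d + suc ⌊ d /2⌋ + suc ⌈ d /2⌉
    ≡⟨ +-assoc (diagonalOffset d) _ _ ⟩
  diagonalOffset d + suc (⌊ d /2⌋ + suc ⌈ d /2⌉)
    ≡⟨ cong (λ x → diagonalOffset d + suc x) (+-suc ⌊ d /2⌋ _) ⟩
  diagonalOffset d + suc (suc (⌊ d /2⌋ + ⌈ d /2⌉))
    ≡⟨ cong (λ x → diagonalOffset d + suc (suc x)) (⌊n/2⌋+⌈n/2⌉≡n d) ⟩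
  diagonalOffset d + suc (suc d) ∎

-- In the step case the remainder `suc (suc (suc d)) % 2` reduces to `suc d % 2`.
diagonalOffset-quarterSquare : ∀ d → diagonalOffset d * 4 + suc d % 2 ≡ suc d * suc d
diagonalOffset-quarterSquare zero          = refl
diagonalOffset-quarterSquare (suc zero)    = refl
diagonalOffset-quarterSquare (suc (suc d)) = begin
  diagonalOffset (suc (suc d)) * 4 + suc d % 2
    ≡⟨ cong (λ t → t * 4 + suc d % 2) (diagonalOffset-+2 d) ⟩
  (diagonalOffset d + suc (suc d)) * 4 + suc d % 2
    ≡⟨ regroup (diagonalOffset d) (suc d % 2) d ⟩
  (diagonalOffset d * 4 + suc d % 2) + (d * 4 + 8)
    ≡⟨ cong (_+ (d * 4 + 8)) (diagonalOffset-quarterSquare d) ⟩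
  suc d * suc d + (d * 4 + 8)
    ≡⟨ square-step d ⟩
  suc (suc (suc d)) * suc (suc (suc d)) ∎
  where
  regroup : ∀ t r d → (t + suc (suc d)) * 4 + r ≡ (t * 4 + r) + (d * 4 + 8)
  regroup = solve-∀
  square-step : ∀ d → suc d * suc d + (d * 4 + 8) ≡ suc (suc (suc d)) * suc (suc (suc d))
  square-step = solve-∀

G≡diagonalOffset+⊓ : ∀ m n → G m n ≡ diagonalOffset (m + n) + m ⊓ n
G≡diagonalOffset+⊓ m n = cong (_+ m ⊓ n) (begin
  (s * s ∸ s % 2) / 4
    ≡⟨ cong (λ x → (x * x ∸ x % 2) / 4) (+-comm (m + n) 1) ⟩
  (suc d * suc d ∸ suc d % 2) / 4
    ≡⟨ cong (λ x → (x ∸ suc d % 2) / 4) (sym (diagonalOffset-quarterSquare d)) ⟩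
  (diagonalOffset d * 4 + suc d % 2 ∸ suc d % 2) / 4
    ≡⟨ cong (_/ 4) (m+n∸n≡m (diagonalOffset d * 4) (suc d % 2)) ⟩
  diagonalOffset d * 4 / 4
    ≡⟨ m*n/n≡m (diagonalOffset d) 4 ⟩
  diagonalOffset d ∎)
  where
  d = m + n
  s = m + n + 1

diagonalOffset-mono-≤ : ∀ {d e} → d ≤ e → diagonalOffset d ≤ diagonalOffset e
diagonalOffset-mono-≤ d≤e = go (≤⇒≤′ d≤e)
  where
  go : ∀ {d e} → d ≤′ e → diagonalOffset d ≤ diagonalOffset e
  go ≤′-refl       = ≤-refl
  go (≤′-step d≤e) = ≤-trans (go d≤e) (m≤m+n _ _)

diagonalCode-<-next : ∀ {a} d → a ≤ ⌊ d /2⌋ → diagonalOffset d + a < diagonalOffset (suc d)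
diagonalCode-<-next d a≤ = +-monoʳ-< (diagonalOffset d) (s≤s a≤)

diagonalCode-<-later : ∀ {a d e} b → a ≤ ⌊ d /2⌋ → d < e → diagonalOffset d + a < diagonalOffset e + b
diagonalCode-<-later {d = d} b a≤ d<e =
  <-≤-trans (diagonalCode-<-next d a≤) (≤-trans (diagonalOffset-mono-≤ d<e) (m≤m+n _ b))

diagonalCode-injective : ∀ {a b d e} → a ≤ ⌊ d /2⌋ → b ≤ ⌊ e /2⌋ →
  diagonalOffset d + a ≡ diagonalOffset e + b → d ≡ e × a ≡ b
diagonalCode-injective {a} {b} {d} {e} a≤ b≤ eq with <-cmp d e
... | tri< d<e _ _ = ⊥-elim (<-irrefl eq (diagonalCode-<-later b a≤ d<e))
... | tri> _ _ e<d = ⊥-elim (<-irrefl (sym eq) (diagonalCode-<-later a b≤ e<d))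
... | tri≈ _ refl _ = refl , +-cancelˡ-≡ (diagonalOffset d) a b eq

diagonalCode-surjective : ∀ k → ∃[ d ] ∃[ a ] a ≤ ⌊ d /2⌋ × diagonalOffset d + a ≡ k
diagonalCode-surjective zero = 0 , 0 , z≤n , refl
diagonalCode-surjective (suc k) with diagonalCode-surjective k
... | d , a , a≤ , eq with a <? ⌊ d /2⌋
...   | yes a< = d , suc a , a< , trans (+-suc (diagonalOffset d) a) (cong suc eq)
...   | no a≮ = suc d , 0 , z≤n , (begin
  diagonalOffset d + suc ⌊ d /2⌋ + 0 ≡⟨ +-identityʳ _ ⟩
  diagonalOffset d + suc ⌊ d /2⌋     ≡⟨ cong (λ x → diagonalOffset d + suc x) (sym (≤∧≮⇒≡ a≤ a≮)) ⟩
  diagonalOffset d + suc a           ≡⟨ +-suc (diagonalOffset d) a ⟩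
  suc (diagonalOffset d + a)         ≡⟨ cong suc eq ⟩
  suc k                              ∎)

⊓-≤-⌊+/2⌋ : ∀ m n → m ⊓ n ≤ ⌊ m + n /2⌋
⊓-≤-⌊+/2⌋ m n = subst (_≤ ⌊ m + n /2⌋) (sym (n≡⌊n+n/2⌋ (m ⊓ n)))
  (⌊n/2⌋-mono (+-mono-≤ (m⊓n≤m m n) (m⊓n≤n m n)))

sorted-or-swapped : ∀ x y → (x , y) ≡ (x ⊓ y , x ⊔ y) ⊎ (x , y) ≡ (x ⊔ y , x ⊓ y)
sorted-or-swapped x y with ≤-total x y
... | inj₁ x≤y = inj₁ (cong₂ _,_ (sym (m≤n⇒m⊓n≡m x≤y)) (sym (m≤n⇒m⊔n≡n x≤y)))
... | inj₂ y≤x = inj₂ (cong₂ _,_ (sym (m≥n⇒m⊔n≡m y≤x)) (sym (m≥n⇒m⊓n≡n y≤x)))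

⊓+⊔≡+ : ∀ x y → x ⊓ y + (x ⊔ y) ≡ x + y
⊓+⊔≡+ x y with sorted-or-swapped x y
... | inj₁ eq = sym (cong (uncurry _+_) eq)
... | inj₂ eq = trans (+-comm (x ⊓ y) (x ⊔ y)) (sym (cong (uncurry _+_) eq))

⊔-by-sum-⊓ : ∀ {x₁ y₁ x₂ y₂} → x₁ + y₁ ≡ x₂ + y₂ → x₁ ⊓ y₁ ≡ x₂ ⊓ y₂ → x₁ ⊔ y₁ ≡ x₂ ⊔ y₂
⊔-by-sum-⊓ {x₁} {y₁} {x₂} {y₂} sum≡ min≡ = +-cancelˡ-≡ (x₁ ⊓ y₁) _ _ (begin
  x₁ ⊓ y₁ + (x₁ ⊔ y₁) ≡⟨ ⊓+⊔≡+ x₁ y₁ ⟩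
  x₁ + y₁             ≡⟨ sum≡ ⟩
  x₂ + y₂             ≡⟨ sym (⊓+⊔≡+ x₂ y₂) ⟩
  x₂ ⊓ y₂ + (x₂ ⊔ y₂) ≡⟨ cong (_+ (x₂ ⊔ y₂)) (sym min≡) ⟩
  x₁ ⊓ y₁ + (x₂ ⊔ y₂) ∎)

unorderedPair-by-⊓-⊔ : ∀ {x₁ y₁ x₂ y₂} → (x₁ ⊓ y₁ , x₁ ⊔ y₁) ≡ (x₂ ⊓ y₂ , x₂ ⊔ y₂) →
  (x₁ , y₁) ≡ (x₂ , y₂) ⊎ (x₁ , y₁) ≡ (y₂ , x₂)
unorderedPair-by-⊓-⊔ {x₁} {y₁} {x₂} {y₂} sorted≡
  with sorted-or-swapped x₁ y₁ | sorted-or-swapped x₂ y₂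
... | inj₁ p₁ | inj₁ p₂ = inj₁ (trans p₁ (trans sorted≡ (sym p₂)))
... | inj₁ p₁ | inj₂ p₂ = inj₂ (trans p₁ (trans sorted≡ (cong swap (sym p₂))))
... | inj₂ p₁ | inj₁ p₂ = inj₂ (trans p₁ (cong swap (trans sorted≡ (sym p₂))))
... | inj₂ p₁ | inj₂ p₂ = inj₁ (trans p₁ (trans (cong swap sorted≡) (sym p₂)))

G-symmetric : ∀ m n → G m n ≡ G n m
G-symmetric m n = begin
  G m n                             ≡⟨ G≡diagonalOffset+⊓ m n ⟩
  diagonalOffset (m + n) + m ⊓ n    ≡⟨ cong₂ (λ d a → diagonalOffset d + a) (+-comm m n) (⊓-comm m n) ⟩
  diagonalOffset (n + m) + n ⊓ m    ≡⟨ sym (G≡diagonalOffset+⊓ n m) ⟩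
  G n m                             ∎

G-surjective : ∀ k → ∃[ m ] ∃[ n ] G m n ≡ k
G-surjective k with diagonalCode-surjective k
... | d , a , a≤ , eq = a , d ∸ a , (begin
  G a (d ∸ a)
    ≡⟨ G≡diagonalOffset+⊓ a (d ∸ a) ⟩
  diagonalOffset (a + (d ∸ a)) + a ⊓ (d ∸ a)
    ≡⟨ cong₂ (λ d a → diagonalOffset d + a) (m+[n∸m]≡n a≤d) (m≤n⇒m⊓n≡m a≤d∸a) ⟩
  diagonalOffset d + a
    ≡⟨ eq ⟩
  k ∎)
  where
  a+a≤d : a + a ≤ d
  a+a≤d = subst (a + a ≤_) (⌊n/2⌋+⌈n/2⌉≡n d) (+-mono-≤ a≤ (≤-trans a≤ (⌊n/2⌋≤⌈n/2⌉ d)))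
  a≤d : a ≤ d
  a≤d = m+n≤o⇒m≤o a a+a≤d
  a≤d∸a : a ≤ d ∸ a
  a≤d∸a = m+n≤o⇒m≤o∸n a a+a≤d

G-injective-up-to-swap : ∀ {x₁ y₁ x₂ y₂} → G x₁ y₁ ≡ G x₂ y₂ →
  (x₁ , y₁) ≡ (x₂ , y₂) ⊎ (x₁ , y₁) ≡ (y₂ , x₂)
G-injective-up-to-swap {x₁} {y₁} {x₂} {y₂} eq
  with diagonalCode-injective (⊓-≤-⌊+/2⌋ x₁ y₁) (⊓-≤-⌊+/2⌋ x₂ y₂)
         (trans (sym (G≡diagonalOffset+⊓ x₁ y₁)) (trans eq (G≡diagonalOffset+⊓ x₂ y₂)))
... | sum≡ , min≡ = unorderedPair-by-⊓-⊔ (cong₂ _,_ min≡ (⊔-by-sum-⊓ sum≡ min≡))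

G-swap-invariant : ∀ {x₁ y₁ x₂ y₂} → (x₁ , y₁) ≡ (x₂ , y₂) ⊎ (x₁ , y₁) ≡ (y₂ , x₂) →
  G x₁ y₁ ≡ G x₂ y₂
G-swap-invariant (inj₁ refl) = refl
G-swap-invariant {x₂ = x₂} {y₂} (inj₂ refl) = G-symmetric y₂ x₂

corollary1 :
    (∀ m n → G m n ≡ G n m)
    × (∀ k → ∃[ m ] ∃[ n ] G m n ≡ k)
    × (∀ x₁ y₁ x₂ y₂ →
         (G x₁ y₁ ≡ G x₂ y₂ → (x₁ , y₁) ≡ (x₂ , y₂) ⊎ (x₁ , y₁) ≡ (y₂ , x₂))
         × ((x₁ , y₁) ≡ (x₂ , y₂) ⊎ (x₁ , y₁) ≡ (y₂ , x₂) → G x₁ y₁ ≡ G x₂ y₂))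
corollary1 = G-symmetric , G-surjective , λ _ _ _ _ → G-injective-up-to-swap , G-swap-invariant
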